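{- Let $G$ be a complete $(m,n)$-mixed graph (i.e. $U(G)=K_{|V(G)|}$) with $\chi_s(G)>2$. Then, up to relabelling of the colours, $G$ has a unique minimum simple colouring; that is, any two minimum simple colourings $c, c'$ of $G$ satisfy $c(u)=c(v) \iff c'(u)=c'(v)$ for all $u,v\in V(G)$.
   Context: An $(m,n)$-mixed graph $G=(V,A,E)$ is a simple graph (no loops, at most one adjacency between any pair of vertices) in which each adjacency is either an arc or an edge, with colour functions $c_A: A \to \{1,\dots,m\}$, $c_E: E \to \{1,\dots,n\}$; $U(G)$ is its underlying simple graph. A simple homomorphism $\phi: G\to_s H$ is a map $V(G)\to V(H)$ such that either $|V(G)|=1$, or $\phi$ is non-constant and every adjacency $uv$ with $\phi(u)\neq\phi(v)$ is mapped to an adjacency of the same type (edge/arc, same direction, same colour); $\chi_s(G)$ is the least number of vertices of an $H$ with $G\to_s H$, and a minimum simple colouring is a simple homomorphism to an $(m,n)$-mixed graph on $\chi_s(G)$ vertices. -}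

module Defs where

open import Data.Nat using (ℕ; _≤_; _<_)
open import Data.Fin using (Fin)
open import Data.Product using (Σ; ∃; ∃-syntax; _×_; _,_)
open import Data.Sum using (_⊎_)
open import Relation.Binary.PropositionalEquality using (_≡_; _≢_)

-- The adjacency between an ordered pair of vertices (u , v) in an
-- (m,n)-mixed graph: none, an edge of colour j, an arc u→v of colour i,
-- or an arc v→u of colour i.
data Adj (m n : ℕ) : Set where
  none   : Adj m n
  edge   : Fin n → Adj m n
  arcOut : Fin m → Adj m n
  arcIn  : Fin m → Adj m n

rev : ∀ {m n} → Adj m n → Adj m n
rev none       = none
rev (edge j)   = edge j
rev (arcOut i) = arcIn i
rev (arcIn i)  = arcOut i

record MixedGraph (m n : ℕ) : Set where
  field
    size    : ℕ
    adj     : Fin size → Fin size → Adj m n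
    noLoops : ∀ u → adj u u ≡ none
    adjSym  : ∀ u v → adj v u ≡ rev (adj u v)
open MixedGraph public

Complete : ∀ {m n} → MixedGraph m n → Set
Complete G = ∀ u v → u ≢ v → adj G u v ≢ none

IsSimpleHom : ∀ {m n} (G H : MixedGraph m n) → (Fin (size G) → Fin (size H)) → Set
IsSimpleHom G H φ =
  (size G ≡ 1 ⊎ (∃[ u ] ∃[ v ] φ u ≢ φ v))
  × (∀ u v → adj G u v ≢ none → φ u ≢ φ v → adj H (φ u) (φ v) ≡ adj G u v)

-- φ : G →s H is a minimum simple colouring: H has χ_s(G) vertices, i.e.
-- no simple homomorphism of G targets a graph with fewer vertices.
record IsMinSimpleColouring {m n : ℕ} (G H : MixedGraph m n)
    (φ : Fin (size G) → Fin (size H)) : Set where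
  field
    simpleHom : IsSimpleHom G H φ
    minimum   : ∀ (H' : MixedGraph m n) (φ' : Fin (size G) → Fin (size H')) →
                IsSimpleHom G H' φ' → size H ≤ size H'

χs>2 : ∀ {m n} → MixedGraph m n → Set
χs>2 {m} {n} G = ∀ (H : MixedGraph m n) (φ : Fin (size G) → Fin (size H)) →
  IsSimpleHom G H φ → 2 < size H

-- On a complete graph, a simple homomorphism is the same as a non-constant
-- colouring whose colour classes are modules (every outside vertex is joined
-- to all vertices of a class in the same way), the target being the quotient.
-- Let c be any such colouring and c' a minimum one, and suppose c u = c v but
-- c' u ≠ c' v.  The union B of the c'-classes meeting the c-class of u is again
-- a module.  If B is not everything, recolouring B with the single colour c' u
-- is modular and leaves c' v unused, contradicting minimality.  If B is
-- everything, then for a vertex z outside the c-class of u, the c'-class of z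
-- and its complement are both modules, a simple colouring with two colours,
-- contradicting χ_s(G) > 2.
module Submission where

open import Defs
open import Data.Nat using (ℕ; suc; _≤_; s≤s)
open import Data.Nat.Properties using (<-irrefl)
open import Data.Fin using (Fin; punchOut) renaming (zero to fzero; suc to fsuc)
open import Data.Fin.Properties using (_≟_; any?; all?; ¬∀⟶∃¬; punchOut-injective; punchOut-cong)
open import Data.Product using (∃; ∃-syntax; _×_; _,_; proj₂)
open import Data.Sum using (inj₁; inj₂)
open import Data.Empty using (⊥; ⊥-elim)
open import Level using (0ℓ)
open import Relation.Nullary using (Dec; yes; no; ¬_)
open import Relation.Nullary.Decidable using (_×-dec_; decidable-stable)
open import Relation.Unary using (Pred; Decidable; ∁)
open import Relation.Binary.PropositionalEquality
open import Function.Base using (_∘_)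
open import Function.Bundles using (_⇔_; mk⇔)

module _ {m n : ℕ} (G : MixedGraph m n) where

  private
    V = Fin (size G)

  IsModule : Pred V 0ℓ → Set
  IsModule B = ∀ {x x' w} → B x → B x' → ¬ B w → adj G x w ≡ adj G x' w

  module-adjʳ : ∀ {B} → IsModule B → ∀ {x x' w} → B x → B x' → ¬ B w →
                adj G w x ≡ adj G w x'
  module-adjʳ isMod {x} {x'} {w} x∈B x'∈B w∉B = begin
    adj G w x        ≡⟨ adjSym G x w ⟩
    rev (adj G x w)  ≡⟨ cong rev (isMod x∈B x'∈B w∉B) ⟩
    rev (adj G x' w) ≡⟨ adjSym G x' w ⟨
    adj G w x'       ∎
    where open ≡-Reasoning

  IsModularColouring : ∀ {K} → (V → Fin K) → Set
  IsModularColouring ψ = ∀ a → IsModule (λ x → ψ x ≡ a)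

  NonConstant : ∀ {K} → (V → Fin K) → Set
  NonConstant ψ = ∃[ u ] ∃[ v ] ψ u ≢ ψ v

  modular-adj-cong : ∀ {K} {ψ : V → Fin K} → IsModularColouring ψ →
                     ∀ {u u' v v'} → ψ u ≡ ψ u' → ψ v ≡ ψ v' → ψ u ≢ ψ v →
                     adj G u v ≡ adj G u' v'
  modular-adj-cong {ψ = ψ} mod {u} {u'} {v} {v'} uu' vv' u≁v =
    trans (mod (ψ u) refl (sym uu') (λ e → u≁v (sym e)))
          (module-adjʳ (mod (ψ v)) refl (sym vv') (λ e → u≁v (trans uu' e)))

  simpleHom⇒modular : Complete G → ∀ {H : MixedGraph m n} {c : V → Fin (size H)} →
                      IsSimpleHom G H c → IsModularColouring c
  simpleHom⇒modular complete {H} {c} (_ , preserves) a {x} {x'} {w} cx≡a cx'≡a cw≢a = begin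
    adj G x w           ≡⟨ preserves x w (adjacent x cx≡a) (separated x cx≡a) ⟨
    adj H (c x) (c w)   ≡⟨ cong (λ p → adj H p (c w)) (trans cx≡a (sym cx'≡a)) ⟩
    adj H (c x') (c w)  ≡⟨ preserves x' w (adjacent x' cx'≡a) (separated x' cx'≡a) ⟩
    adj G x' w          ∎
    where
      open ≡-Reasoning
      separated : ∀ y → c y ≡ a → c y ≢ c w
      separated y cy≡a e = cw≢a (trans (sym e) cy≡a)
      adjacent : ∀ y → c y ≡ a → adj G y w ≢ none
      adjacent y cy≡a = complete y w (λ y≡w → separated y cy≡a (cong c y≡w))

  -- The quotient of G by a colouring: colour classes p ≠ q are joined as any
  -- representatives are, which is well defined when the colouring is modular.
  module _ {K} (ψ : V → Fin K) where

    private
      Preimage : Fin K → Set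
      Preimage p = ∃ λ u → ψ u ≡ p

      quotientAdj : ∀ {p q} → Dec (p ≡ q) → Dec (Preimage p) → Dec (Preimage q) → Adj m n
      quotientAdj (no _) (yes (u , _)) (yes (v , _)) = adj G u v
      quotientAdj _      _             _             = none

      quotientAdj-loop : ∀ {p} (p≟p : Dec (p ≡ p)) a b → quotientAdj p≟p a b ≡ none
      quotientAdj-loop (yes _)  _ _ = refl
      quotientAdj-loop (no p≢p) _ _ = ⊥-elim (p≢p refl)

      quotientAdj-sym : ∀ {p q} (p≟q : Dec (p ≡ q)) (q≟p : Dec (q ≡ p)) a b →
                        quotientAdj q≟p b a ≡ rev (quotientAdj p≟q a b)
      quotientAdj-sym (yes _)   (yes _)   _             _             = refl
      quotientAdj-sym (yes p≡q) (no q≢p)  _             _             = ⊥-elim (q≢p (sym p≡q))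
      quotientAdj-sym (no p≢q)  (yes q≡p) _             _             = ⊥-elim (p≢q (sym q≡p))
      quotientAdj-sym (no _)    (no _)    (yes (u , _)) (yes (v , _)) = adjSym G u v
      quotientAdj-sym (no _)    (no _)    (yes _)       (no _)        = refl
      quotientAdj-sym (no _)    (no _)    (no _)        (yes _)       = refl
      quotientAdj-sym (no _)    (no _)    (no _)        (no _)        = refl

      quotientAdj-rep : IsModularColouring ψ → ∀ {p q} (p≟q : Dec (p ≡ q)) a b → p ≢ q →
                        ∀ {u v} → ψ u ≡ p → ψ v ≡ q → quotientAdj p≟q a b ≡ adj G u v
      quotientAdj-rep mod (yes p≡q) _ _ p≢q _ _ = ⊥-elim (p≢q p≡q)
      quotientAdj-rep mod (no _) (yes (u₀ , ψu₀≡p)) (yes (v₀ , ψv₀≡q)) p≢q ψu≡p ψv≡q =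
        modular-adj-cong mod (trans ψu₀≡p (sym ψu≡p)) (trans ψv₀≡q (sym ψv≡q))
                         (λ e → p≢q (trans (sym ψu₀≡p) (trans e ψv₀≡q)))
      quotientAdj-rep mod (no _) (yes _) (no ∄v) _ _ ψv≡q = ⊥-elim (∄v (_ , ψv≡q))
      quotientAdj-rep mod (no _) (no ∄u) _       _ ψu≡p _ = ⊥-elim (∄u (_ , ψu≡p))

      preimage? : ∀ p → Dec (Preimage p)
      preimage? p = any? (λ u → ψ u ≟ p)

    quotient : MixedGraph m n
    quotient = record
      { size    = K
      ; adj     = λ p q → quotientAdj (p ≟ q) (preimage? p) (preimage? q)
      ; noLoops = λ p → quotientAdj-loop (p ≟ p) (preimage? p) (preimage? p)
      ; adjSym  = λ p q → quotientAdj-sym (p ≟ q) (q ≟ p) (preimage? p) (preimage? q)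
      }

    quotient-simpleHom : IsModularColouring ψ → NonConstant ψ → IsSimpleHom G quotient ψ
    quotient-simpleHom mod nonConst =
      inj₂ nonConst , λ u v _ ψu≢ψv → quotientAdj-rep mod (ψ u ≟ ψ v) _ _ ψu≢ψv refl refl

  modular-kernel : ∀ {K L} {ψ : V → Fin K} {φ : V → Fin L} → IsModularColouring ψ →
                   (∀ x y → φ x ≡ φ y → ψ x ≡ ψ y) → (∀ x y → ψ x ≡ ψ y → φ x ≡ φ y) →
                   IsModularColouring φ
  modular-kernel {ψ = ψ} mod φ⇒ψ ψ⇒φ a {x} {x'} {w} φx≡a φx'≡a φw≢a =
    mod (ψ x) refl (φ⇒ψ x' x (trans φx'≡a (sym φx≡a))) (λ e → φw≢a (trans (ψ⇒φ w x e) φx≡a))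

  nonConstant-avoids : ∀ {K} {ψ : V → Fin K} → NonConstant ψ → ∀ a → ∃ λ z → ψ z ≢ a
  nonConstant-avoids {ψ = ψ} (u , v , ψu≢ψv) a with ψ u ≟ a
  ... | no ψu≢a  = u , ψu≢a
  ... | yes ψu≡a = v , λ ψv≡a → ψu≢ψv (trans ψu≡a (sym ψv≡a))

  module _ {K} {B : Pred V 0ℓ} (B? : Decidable B) (p : Fin K) (ψ : V → Fin K) where

    merge : V → Fin K
    merge x with B? x
    ... | yes _ = p
    ... | no  _ = ψ x

    merge-∈ : ∀ {x} → B x → merge x ≡ p
    merge-∈ {x} x∈B with B? x
    ... | yes _   = refl
    ... | no x∉B = ⊥-elim (x∉B x∈B)

    merge-∉ : ∀ {x} → ¬ B x → merge x ≡ ψ x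
    merge-∉ {x} x∉B with B? x
    ... | yes x∈B = ⊥-elim (x∉B x∈B)
    ... | no _    = refl

    merge-modular : IsModularColouring ψ → IsModule B → (∀ {x y} → ψ x ≡ ψ y → B x → B y) →
                    (∀ {y} → ψ y ≡ p → B y) → IsModularColouring merge
    merge-modular mod isMod saturated p-in-B a {x} {x'} {w} mx≡a mx'≡a mw≢a with B? x | B? x'
    ... | yes x∈B | yes x'∈B = isMod x∈B x'∈B (λ w∈B → mw≢a (trans (merge-∈ w∈B) mx≡a))
    ... | yes _   | no x'∉B  = ⊥-elim (x'∉B (p-in-B (trans mx'≡a (sym mx≡a))))
    ... | no x∉B  | yes _    = ⊥-elim (x∉B (p-in-B (trans mx≡a (sym mx'≡a))))
    ... | no x∉B  | no _     = mod a mx≡a mx'≡a ψw≢a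
      where
        ψw≢a : ψ w ≢ a
        ψw≢a ψw≡a with B? w
        ... | yes w∈B = x∉B (saturated (trans ψw≡a (sym mx≡a)) w∈B)
        ... | no _    = mw≢a ψw≡a

  module _ {B : Pred V 0ℓ} (B? : Decidable B) where

    indicator : V → Fin 2
    indicator = merge B? fzero (λ _ → fsuc fzero)

    indicator-modular : IsModule B → IsModule (∁ B) → IsModularColouring indicator
    indicator-modular isMod isMod∁ a {x} {x'} {w} ιx≡a ιx'≡a ιw≢a with B? x | B? x'
    ... | yes x∈B | yes x'∈B = isMod x∈B x'∈B (λ w∈B → ιw≢a (trans (merge-∈ B? _ _ w∈B) ιx≡a))
    ... | no x∉B  | no x'∉B  = isMod∁ x∉B x'∉B (λ w∉B → ιw≢a (trans (merge-∉ B? _ _ w∉B) ιx≡a))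
    ... | yes _   | no _ with () ← trans ιx≡a (sym ιx'≡a)
    ... | no _    | yes _ with () ← trans ιx≡a (sym ιx'≡a)

    indicator-nonConstant : ∀ {x y} → B x → ¬ B y → NonConstant indicator
    indicator-nonConstant {x} {y} x∈B y∉B = x , y , 0≢1
      where
        0≢1 : indicator x ≢ indicator y
        0≢1 ιx≡ιy with () ← trans (sym (merge-∈ B? _ _ x∈B)) (trans ιx≡ιy (merge-∉ B? _ _ y∉B))

  private
    point : MixedGraph m n
    point = record { size = 1 ; adj = λ _ _ → none ; noLoops = λ _ → refl ; adjSym = λ _ _ → refl }

  χs>2⇒nonConstant : χs>2 G → ∀ {H : MixedGraph m n} {c : V → Fin (size H)} →
                     IsSimpleHom G H c → NonConstant c
  χs>2⇒nonConstant _   (inj₂ nonConst , _) = nonConst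
  χs>2⇒nonConstant χ>2 (inj₁ |G|≡1 , _)
    with s≤s () ← χ>2 point (λ _ → fzero) (inj₁ |G|≡1 , λ _ _ _ 0≢0 → ⊥-elim (0≢0 refl))

  χs>2⇒no-module-bipartition : χs>2 G → ∀ {B} → Decidable B → IsModule B → IsModule (∁ B) →
                               ∀ {x y} → B x → ¬ B y → ⊥
  χs>2⇒no-module-bipartition χ>2 B? isMod isMod∁ {x} {y} x∈B y∉B
    with s≤s (s≤s ()) ← χ>2 (quotient (indicator B?)) (indicator B?)
                            (quotient-simpleHom (indicator B?) (indicator-modular B? isMod isMod∁)
                                                (indicator-nonConstant B? x∈B y∉B))

  BoundsModularColourings : ℕ → Set
  BoundsModularColourings K = ∀ {L} (φ : V → Fin L) → IsModularColouring φ → NonConstant φ → K ≤ L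

  minimum⇒bound : ∀ {H : MixedGraph m n} {c : V → Fin (size H)} →
                  IsMinSimpleColouring G H c → BoundsModularColourings (size H)
  minimum⇒bound min φ mod nonConst =
    IsMinSimpleColouring.minimum min (quotient φ) φ (quotient-simpleHom φ mod nonConst)

  -- An unused colour can be punched out of Fin K without changing the kernel.
  bound⇒colour-used : ∀ {K} → BoundsModularColourings K → (ψ : V → Fin K) →
                      IsModularColouring ψ → NonConstant ψ → ∀ p → ¬ (∀ x → ψ x ≢ p)
  bound⇒colour-used {suc K} bound ψ mod (u , v , ψu≢ψv) p unused =
    <-irrefl refl (bound ψ' (modular-kernel mod injective (λ _ _ → punchOut-cong p))
                            (u , v , ψu≢ψv ∘ injective u v))
    where
      ψ' : V → Fin K
      ψ' x = punchOut (λ p≡ψx → unused x (sym p≡ψx))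
      injective : ∀ x y → ψ' x ≡ ψ' y → ψ x ≡ ψ y
      injective _ _ = punchOut-injective {i = p} _ _

  module _ {K K'} {c : V → Fin K} {c' : V → Fin K'}
           (mod : IsModularColouring c) (mod' : IsModularColouring c') where

    Closure : V → Pred V 0ℓ
    Closure u x = ∃ λ y → c y ≡ c u × c' y ≡ c' x

    closure? : ∀ u → Decidable (Closure u)
    closure? u x = any? (λ y → (c y ≟ c u) ×-dec (c' y ≟ c' x))

    closure-adj : ∀ {u x x' w} → Closure u x → Closure u x' →
                  c w ≢ c u → c' w ≢ c' x → c' w ≢ c' x' → adj G x w ≡ adj G x' w
    closure-adj {u} {x} {x'} {w} (y , cy≡cu , c'y≡c'x) (y' , cy'≡cu , c'y'≡c'x') cw≢cu c'w≢c'x c'w≢c'x' = begin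
      adj G x w   ≡⟨ mod' (c' x) refl c'y≡c'x c'w≢c'x ⟩
      adj G y w   ≡⟨ mod (c u) cy≡cu cy'≡cu cw≢cu ⟩
      adj G y' w  ≡⟨ mod' (c' x') refl c'y'≡c'x' c'w≢c'x' ⟨
      adj G x' w  ∎
      where open ≡-Reasoning

    closure-module : ∀ u → IsModule (Closure u)
    closure-module u x∈ x'∈ w∉ =
      closure-adj x∈ x'∈ (λ cw≡cu → w∉ (_ , cw≡cu , refl)) (separated x∈) (separated x'∈)
      where
        separated : ∀ {x} → Closure u x → c' _ ≢ c' x
        separated (y , cy≡cu , c'y≡c'x) c'w≡c'x = w∉ (y , cy≡cu , trans c'y≡c'x (sym c'w≡c'x))

    closure-proper-impossible : BoundsModularColourings K' → ∀ {u v x₀} → c v ≡ c u → c' u ≢ c' v →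
                                ¬ Closure u x₀ → ⊥
    closure-proper-impossible bound {u} {v} {x₀} cv≡cu c'u≢c'v x₀∉ =
      bound⇒colour-used bound ψ
        (merge-modular (closure? u) (c' u) c' mod' (closure-module u) saturated (λ e → u , refl , sym e))
        nonConst (c' v) unused
      where
        ψ : V → Fin K'
        ψ = merge (closure? u) (c' u) c'
        saturated : ∀ {x y} → c' x ≡ c' y → Closure u x → Closure u y
        saturated c'x≡c'y (y , cy≡cu , c'y≡c'x) = y , cy≡cu , trans c'y≡c'x c'x≡c'y
        nonConst : NonConstant ψ
        nonConst = u , x₀ , λ ψu≡ψx₀ → x₀∉ (u , refl ,
          trans (sym (merge-∈ (closure? u) _ _ (u , refl , refl))) (trans ψu≡ψx₀ (merge-∉ (closure? u) _ _ x₀∉)))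
        unused : ∀ x → ψ x ≢ c' v
        unused x ψx≡c'v with closure? u x
        ... | yes _  = c'u≢c'v ψx≡c'v
        ... | no x∉ = x∉ (v , cv≡cu , sym ψx≡c'v)

    closure-total-impossible : χs>2 G → NonConstant c → ∀ {u v} → c' u ≢ c' v → (∀ x → Closure u x) → ⊥
    closure-total-impossible χ>2 nonConst {u} {v} c'u≢c'v total
      with z , cz≢cu ← nonConstant-avoids nonConst (c u)
      with y , c'y≢c'z ← nonConstant-avoids (u , v , c'u≢c'v) (c' z)
      = χs>2⇒no-module-bipartition χ>2 (λ x → c' x ≟ c' z) (mod' (c' z)) outsideModule refl c'y≢c'z
      where
        outsideModule : IsModule (∁ (λ x → c' x ≡ c' z))
        outsideModule {x} {x'} {w} x∉Z x'∉Z w∉∁Z = begin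
          adj G x w   ≡⟨ module-adjʳ (mod' (c' z)) w∈Z refl x∉Z ⟩
          adj G x z   ≡⟨ closure-adj (total x) (total x') cz≢cu (x∉Z ∘ sym) (x'∉Z ∘ sym) ⟩
          adj G x' z  ≡⟨ module-adjʳ (mod' (c' z)) w∈Z refl x'∉Z ⟨
          adj G x' w  ∎
          where
            open ≡-Reasoning
            w∈Z : c' w ≡ c' z
            w∈Z = decidable-stable (c' w ≟ c' z) w∉∁Z

    modular-refines-minimal : χs>2 G → NonConstant c → BoundsModularColourings K' →
                              ∀ {u v} → c u ≡ c v → c' u ≡ c' v
    modular-refines-minimal χ>2 nonConst bound {u} {v} cu≡cv with c' u ≟ c' v
    ... | yes c'u≡c'v = c'u≡c'v
    ... | no c'u≢c'v with all? (closure? u)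
    ...   | yes total  = ⊥-elim (closure-total-impossible χ>2 nonConst c'u≢c'v total)
    ...   | no ¬total =
      ⊥-elim (closure-proper-impossible bound (sym cu≡cv) c'u≢c'v (proj₂ (¬∀⟶∃¬ _ _ (closure? u) ¬total)))

mainTheorem15 : ∀ {m n : ℕ} (G : MixedGraph m n) → Complete G → χs>2 G →
    ∀ (H : MixedGraph m n) (c : Fin (size G) → Fin (size H))
      (H' : MixedGraph m n) (c' : Fin (size G) → Fin (size H')) →
    IsMinSimpleColouring G H c → IsMinSimpleColouring G H' c' →
    ∀ (u v : Fin (size G)) → (c u ≡ c v) ⇔ (c' u ≡ c' v)
mainTheorem15 {m} {n} G complete χ>2 H c H' c' min min' u v = mk⇔ (refines min min') (refines min' min)
  where
    open IsMinSimpleColouring using (simpleHom)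
    refines : ∀ {H₁ H₂ : MixedGraph m n} {c₁ : Fin (size G) → Fin (size H₁)} {c₂ : Fin (size G) → Fin (size H₂)} →
              IsMinSimpleColouring G H₁ c₁ → IsMinSimpleColouring G H₂ c₂ → c₁ u ≡ c₁ v → c₂ u ≡ c₂ v
    refines {H₁} {H₂} min₁ min₂ =
      modular-refines-minimal G (simpleHom⇒modular G complete {H₁} (simpleHom min₁))
                                (simpleHom⇒modular G complete {H₂} (simpleHom min₂))
                                χ>2 (χs>2⇒nonConstant G χ>2 {H₁} (simpleHom min₁)) (minimum⇒bound G min₂)
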